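{- For $h\ge 1$, let $\Gamma_h$ be the 1-2 drawing of the complete ternary tree $T_h$ constructed by using Construction 2 only, i.e., $\Gamma_1$ is a single node at a grid point, and for $h\ge 2$, $\Gamma_h$ is obtained by Construction 2 with $\Gamma^a,\Gamma^b,\Gamma^c$ all being copies of $\Gamma_{h-1}$. Then $\Gamma_h$ has width $(2^{h+1}-1)/3$ and height $(2^{h+1}-1)/3$ if $h$ is odd, and width $(2^{h+1}+1)/3$ and height $(2^{h+1}-2)/3$ if $h$ is even.
   Context: $T_h$ denotes the complete ternary tree: every non-leaf node has exactly three children and every root-to-leaf path has exactly $h$ nodes. A drawing means a planar straight-line orthogonal grid drawing: nodes at distinct integer points, each edge a horizontal or vertical segment, no crossings. The width (height) of a drawing is the number of vertical (horizontal) grid lines intersecting it. Construction 2: given three drawings $\Gamma^a,\Gamma^b,\Gamma^c$ of $T_{h-1}$, place the root $r$ of $T_h$ at a grid point; rotate $\Gamma^b$ clockwise by $90^\circ$ and translate it so that its rightmost intersected grid column is one unit to the left of $r$ and its root lies on the horizontal line through $r$; rotate $\Gamma^c$ counterclockwise by $90^\circ$ and translate it so that its leftmost intersected grid column is one unit to the right of $r$ and its root lies on the horizontal line through $r$; translate $\Gamma^a$ so that its topmost intersected grid row is one unit below the lowest grid row intersecting $\Gamma^b$ or $\Gamma^c$ and its root lies on the vertical line through $r$; connect $r$ to the three roots. -}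

module Defs where

open import Data.Nat using (ℕ; zero; suc; _≤_; s≤s; z≤n)
open import Data.Integer using (ℤ; +_; _+_; _-_; -_; _⊓_; _⊔_)
open import Data.Product using (_×_; _,_; proj₁; proj₂)

-- Grid points (x , y): x grows to the right, y grows upward.
Pt : Set
Pt = ℤ × ℤ

-- A drawing of the complete ternary tree T_h: every node of T_h carries
-- its grid position.  Edges are the parent-child segments.
data Drawing : ℕ → Set where
  leaf : Pt → Drawing 1
  node : ∀ {n} → Pt → Drawing (suc n) → Drawing (suc n) → Drawing (suc n)
       → Drawing (suc (suc n))

root : ∀ {n} → Drawing n → Pt
root (leaf p) = p
root (node p _ _ _) = p

mapPt : ∀ {n} → (Pt → Pt) → Drawing n → Drawing n
mapPt f (leaf p) = leaf (f p)
mapPt f (node p a b c) = node (f p) (mapPt f a) (mapPt f b) (mapPt f c)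

translate : ∀ {n} → ℤ → ℤ → Drawing n → Drawing n
translate dx dy = mapPt (λ p → (proj₁ p + dx , proj₂ p + dy))

rotCW : ∀ {n} → Drawing n → Drawing n
rotCW = mapPt (λ p → (proj₂ p , - proj₁ p))

rotCCW : ∀ {n} → Drawing n → Drawing n
rotCCW = mapPt (λ p → (- proj₂ p , proj₁ p))

-- extreme coordinates over all nodes (edges lie between nodes, so the
-- grid lines met by the drawing are exactly those between the extremes)
minX maxX minY maxY : ∀ {n} → Drawing n → ℤ
minX (leaf p) = proj₁ p
minX (node p a b c) = proj₁ p ⊓ (minX a ⊓ (minX b ⊓ minX c))
maxX (leaf p) = proj₁ p
maxX (node p a b c) = proj₁ p ⊔ (maxX a ⊔ (maxX b ⊔ maxX c))
minY (leaf p) = proj₂ p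
minY (node p a b c) = proj₂ p ⊓ (minY a ⊓ (minY b ⊓ minY c))
maxY (leaf p) = proj₂ p
maxY (node p a b c) = proj₂ p ⊔ (maxY a ⊔ (maxY b ⊔ maxY c))

-- number of vertical / horizontal grid lines intersecting the drawing
width height : ∀ {n} → Drawing n → ℤ
width d = maxX d - minX d + + 1
height d = maxY d - minY d + + 1

construction2 : ∀ {n} → Drawing (suc n) → Drawing (suc n) → Drawing (suc n)
              → Drawing (suc (suc n))
construction2 {n} Ga Gb Gc = node (+ 0 , + 0) a' b' c'
  where
  rb : Drawing (suc n)
  rb = rotCW Gb
  b' : Drawing (suc n)
  b' = translate (- + 1 - maxX rb) (- proj₂ (root rb)) rb
  rc : Drawing (suc n)
  rc = rotCCW Gc
  c' : Drawing (suc n)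
  c' = translate (+ 1 - minX rc) (- proj₂ (root rc)) rc
  lowest : ℤ
  lowest = minY b' ⊓ minY c'
  a' : Drawing (suc n)
  a' = translate (- proj₁ (root Ga)) (lowest - + 1 - maxY Ga) Ga

-- Γ' n = Γ_{n+1}
Γ' : (n : ℕ) → Drawing (suc n)
Γ' zero = leaf (+ 0 , + 0)
Γ' (suc n) = construction2 (Γ' n) (Γ' n) (Γ' n)

Γ : (h : ℕ) → 1 ≤ h → Drawing h
Γ (suc n) _ = Γ' n

-- Put the root of Γ_h at the origin. Then Γ_h is symmetric about the vertical line
-- through its root: it reaches ℓ columns to either side, t rows above and b rows below.
-- Construction 2 turns the left and right copies of Γ_{h-1} so that each spans t + b + 1
-- columns and reaches ℓ rows up and down, and hangs the third copy below them. As
-- ℓ ≤ t + b + 1, the new drawing reaches t + b + 1 to either side, ℓ above and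
-- ℓ + t + b + 1 below. Hence width w and height η obey w′ = 2η + 1 and η′ = w + η, and
-- two steps of this recurrence give 3w + 1 = 3η + 1 = 2^(h+1) for odd h and
-- 3w - 1 = 3η + 2 = 2^(h+1) for even h.

module Submission where

open import Data.Integer using (ℤ; +_; -_)
open import Data.Product using (_×_; _,_; proj₁; proj₂; map; map₂)
open import Function using (_∘_)
open import Relation.Binary.PropositionalEquality
  using (_≡_; refl; sym; trans; cong; cong₂; module ≡-Reasoning)

open import Defs

module BoundingBox where

  open import Data.Integer using (_+_; _-_; _⊓_; _⊔_; +≤+)
  open import Data.Integer.Properties
    using (+-identityʳ; neg-involutive; neg-≤-pos; neg-mono-≤; +-monoˡ-≤; ⊓-idem;
           mono-≤-distrib-⊓; mono-≤-distrib-⊔; neg-distrib-⊔-⊓; neg-distrib-⊓-⊔;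
           i≤j⇒i⊓j≡i; i≥j⇒i⊓j≡j)
  open import Data.Integer.Tactic.RingSolver using (solve-∀)
  import Data.Nat as ℕ
  import Data.Nat.Properties as ℕ
  open ≡-Reasoning

  origin : Pt
  origin = + 0 , + 0

  record Box : Set where
    constructor box
    field
      left right bottom top : ℤ

  open Box

  box-cong : ∀ {x₀ x₁ y₀ y₁ x₀′ x₁′ y₀′ y₁′} →
             x₀ ≡ x₀′ → x₁ ≡ x₁′ → y₀ ≡ y₀′ → y₁ ≡ y₁′ →
             box x₀ x₁ y₀ y₁ ≡ box x₀′ x₁′ y₀′ y₁′
  box-cong refl refl refl refl = refl

  point : Pt → Box
  point (x , y) = box x x y y

  infixr 5 _∪_
  _∪_ : Box → Box → Box
  B ∪ C = box (left B ⊓ left C) (right B ⊔ right C) (bottom B ⊓ bottom C) (top B ⊔ top C)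

  -- bbox (node p a b c) is definitionally point p ∪ (bbox a ∪ (bbox b ∪ bbox c)).
  bbox : ∀ {n} → Drawing n → Box
  bbox d = box (minX d) (maxX d) (minY d) (maxY d)

  shift : ℤ → ℤ → Box → Box
  shift dx dy B = box (left B + dx) (right B + dx) (bottom B + dy) (top B + dy)

  turnCW turnCCW : Box → Box
  turnCW B = box (bottom B) (top B) (- right B) (- left B)
  turnCCW B = box (- top B) (- bottom B) (left B) (right B)

  shift-distrib-∪ : ∀ dx dy B C → shift dx dy (B ∪ C) ≡ shift dx dy B ∪ shift dx dy C
  shift-distrib-∪ dx dy B C = box-cong
    (mono-≤-distrib-⊓ (+-monoˡ-≤ dx) (left B) (left C))
    (mono-≤-distrib-⊔ (+-monoˡ-≤ dx) (right B) (right C))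
    (mono-≤-distrib-⊓ (+-monoˡ-≤ dy) (bottom B) (bottom C))
    (mono-≤-distrib-⊔ (+-monoˡ-≤ dy) (top B) (top C))

  turnCW-distrib-∪ : ∀ B C → turnCW (B ∪ C) ≡ turnCW B ∪ turnCW C
  turnCW-distrib-∪ B C =
    box-cong refl refl (neg-distrib-⊔-⊓ (right B) (right C)) (neg-distrib-⊓-⊔ (left B) (left C))

  turnCCW-distrib-∪ : ∀ B C → turnCCW (B ∪ C) ≡ turnCCW B ∪ turnCCW C
  turnCCW-distrib-∪ B C =
    box-cong (neg-distrib-⊔-⊓ (top B) (top C)) (neg-distrib-⊓-⊔ (bottom B) (bottom C)) refl refl

  bbox-mapPt : (f : Pt → Pt) (F : Box → Box) →
               (∀ p → F (point p) ≡ point (f p)) → (∀ B C → F (B ∪ C) ≡ F B ∪ F C) →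
               ∀ {n} (d : Drawing n) → bbox (mapPt f d) ≡ F (bbox d)
  bbox-mapPt f F F-point F-∪ (leaf p) = sym (F-point p)
  bbox-mapPt f F F-point F-∪ (node p a b c) = begin
    point (f p) ∪ bbox (mapPt f a) ∪ bbox (mapPt f b) ∪ bbox (mapPt f c)
      ≡⟨ cong₂ _∪_ (sym (F-point p)) (cong₂ _∪_ (ih a) (cong₂ _∪_ (ih b) (ih c))) ⟩
    F (point p) ∪ F (bbox a) ∪ F (bbox b) ∪ F (bbox c)
      ≡⟨ cong (λ D → F (point p) ∪ F (bbox a) ∪ D) (F-∪ (bbox b) (bbox c)) ⟨
    F (point p) ∪ F (bbox a) ∪ F (bbox b ∪ bbox c)
      ≡⟨ cong (F (point p) ∪_) (F-∪ (bbox a) (bbox b ∪ bbox c)) ⟨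
    F (point p) ∪ F (bbox a ∪ bbox b ∪ bbox c)
      ≡⟨ F-∪ (point p) (bbox a ∪ bbox b ∪ bbox c) ⟨
    F (point p ∪ bbox a ∪ bbox b ∪ bbox c)
      ∎
    where
    ih : ∀ {n} (d : Drawing n) → bbox (mapPt f d) ≡ F (bbox d)
    ih = bbox-mapPt f F F-point F-∪

  bbox-translate : ∀ {n} dx dy (d : Drawing n) → bbox (translate dx dy d) ≡ shift dx dy (bbox d)
  bbox-translate dx dy = bbox-mapPt _ (shift dx dy) (λ _ → refl) (shift-distrib-∪ dx dy)

  bbox-rotCW : ∀ {n} (d : Drawing n) → bbox (rotCW d) ≡ turnCW (bbox d)
  bbox-rotCW = bbox-mapPt _ turnCW (λ _ → refl) turnCW-distrib-∪

  bbox-rotCCW : ∀ {n} (d : Drawing n) → bbox (rotCCW d) ≡ turnCCW (bbox d)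
  bbox-rotCCW = bbox-mapPt _ turnCCW (λ _ → refl) turnCCW-distrib-∪

  root-rotCW : ∀ {n} (d : Drawing n) → root d ≡ origin → root (rotCW d) ≡ origin
  root-rotCW (leaf _) refl = refl
  root-rotCW (node _ _ _ _) refl = refl

  root-rotCCW : ∀ {n} (d : Drawing n) → root d ≡ origin → root (rotCCW d) ≡ origin
  root-rotCCW (leaf _) refl = refl
  root-rotCCW (node _ _ _ _) refl = refl

  width-of-bbox : ∀ {n} (d : Drawing n) {l y₀ y₁} →
                  bbox d ≡ box (- + l) (+ l) y₀ y₁ → width d ≡ + (l ℕ.+ l ℕ.+ 1)
  width-of-bbox d {l} eq = trans (cong (λ B → right B - left B + + 1) eq) (span (+ l))
    where
    span : ∀ x → x - - x + + 1 ≡ x + x + + 1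
    span = solve-∀

  height-of-bbox : ∀ {n} (d : Drawing n) {x₀ x₁ t b} →
                   bbox d ≡ box x₀ x₁ (- + b) (+ t) → height d ≡ + (t ℕ.+ b ℕ.+ 1)
  height-of-bbox d {t = t} {b} eq = trans (cong (λ B → top B - bottom B + + 1) eq) (span (+ t) (+ b))
    where
    span : ∀ x y → x - - y + + 1 ≡ x + y + + 1
    span = solve-∀

  ∪-placed-subtrees : ∀ {l m} → l ℕ.≤ m →
    point origin ∪ box (- + l) (+ l) (- + (l ℕ.+ m)) (- + ℕ.suc l)
                 ∪ box (- + m) (- + 1) (- + l) (+ l)
                 ∪ box (+ 1) (+ m) (- + l) (+ l)
    ≡ box (- + m) (+ m) (- + (l ℕ.+ m)) (+ l)
  ∪-placed-subtrees {l} {m} l≤m = box-cong leftmost (cong +_ (ℕ.m≤n⇒m⊔n≡n l≤m)) lowest (cong +_ (ℕ.⊔-idem l))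
    where
    leftmost : + 0 ⊓ (- + l ⊓ (- + m ⊓ + 1)) ≡ - + m
    leftmost = begin
      + 0 ⊓ (- + l ⊓ (- + m ⊓ + 1)) ≡⟨ cong (λ x → + 0 ⊓ (- + l ⊓ x)) (i≤j⇒i⊓j≡i neg-≤-pos) ⟩
      + 0 ⊓ (- + l ⊓ - + m)         ≡⟨ cong (+ 0 ⊓_) (i≥j⇒i⊓j≡j (neg-mono-≤ (+≤+ l≤m))) ⟩
      + 0 ⊓ - + m                   ≡⟨ i≥j⇒i⊓j≡j neg-≤-pos ⟩
      - + m                         ∎
    lowest : + 0 ⊓ (- + (l ℕ.+ m) ⊓ (- + l ⊓ - + l)) ≡ - + (l ℕ.+ m)
    lowest = begin
      + 0 ⊓ (- + (l ℕ.+ m) ⊓ (- + l ⊓ - + l)) ≡⟨ cong (λ x → + 0 ⊓ (- + (l ℕ.+ m) ⊓ x)) (⊓-idem (- + l)) ⟩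
      + 0 ⊓ (- + (l ℕ.+ m) ⊓ - + l)           ≡⟨ cong (+ 0 ⊓_) (i≤j⇒i⊓j≡i (neg-mono-≤ (+≤+ (ℕ.m≤m+n l m)))) ⟩
      + 0 ⊓ - + (l ℕ.+ m)                     ≡⟨ i≥j⇒i⊓j≡j neg-≤-pos ⟩
      - + (l ℕ.+ m)                           ∎

  bbox-construction2 : ∀ {n} {l t b : ℕ.ℕ} (G : Drawing (ℕ.suc n)) →
    root G ≡ origin → bbox G ≡ box (- + l) (+ l) (- + b) (+ t) → l ℕ.≤ t ℕ.+ b ℕ.+ 1 →
    bbox (construction2 G G G)
      ≡ box (- + (t ℕ.+ b ℕ.+ 1)) (+ (t ℕ.+ b ℕ.+ 1)) (- + (l ℕ.+ (t ℕ.+ b ℕ.+ 1))) (+ l)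
  bbox-construction2 {n} {l} {t} {b} G root≡ bbox≡ l≤m =
    trans (cong₂ (λ A D → point origin ∪ A ∪ D) bbox-a′ (cong₂ _∪_ bbox-b′ bbox-c′))
          (∪-placed-subtrees l≤m)
    where
    m : ℕ.ℕ
    m = t ℕ.+ b ℕ.+ 1

    -- The subdrawings exactly as in construction2, so that bbox (construction2 G G G)
    -- unfolds to point origin ∪ bbox a′ ∪ bbox b′ ∪ bbox c′.
    rb rc b′ c′ a′ : Drawing (ℕ.suc n)
    rb = rotCW G
    rc = rotCCW G
    b′ = translate (- + 1 - maxX rb) (- proj₂ (root rb)) rb
    c′ = translate (+ 1 - minX rc) (- proj₂ (root rc)) rc
    lowest : ℤ
    lowest = minY b′ ⊓ minY c′
    a′ = translate (- proj₁ (root G)) (lowest - + 1 - maxY G) G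

    b′-left : ∀ x y → - y + (- + 1 - x) ≡ - (x + y + + 1)
    b′-left = solve-∀
    b′-right : ∀ x → x + (- + 1 - x) ≡ - + 1
    b′-right = solve-∀
    c′-left : ∀ x → - x + (+ 1 - - x) ≡ + 1
    c′-left = solve-∀
    c′-right : ∀ x y → - - y + (+ 1 - - x) ≡ x + y + + 1
    c′-right = solve-∀
    a′-bottom : ∀ x y z → - z + (- x - + 1 - y) ≡ - (x + (y + z + + 1))
    a′-bottom = solve-∀
    a′-top : ∀ x y → y + (- x - + 1 - y) ≡ - (+ 1 + x)
    a′-top = solve-∀

    bbox-b′ : bbox b′ ≡ box (- + m) (- + 1) (- + l) (+ l)
    bbox-b′ = begin
      bbox b′
        ≡⟨ bbox-translate _ _ rb ⟩
      shift (- + 1 - right (bbox rb)) (- proj₂ (root rb)) (bbox rb)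
        ≡⟨ cong₂ (λ r B → shift (- + 1 - right B) (- proj₂ r) B)
                 (root-rotCW G root≡) (trans (bbox-rotCW G) (cong turnCW bbox≡)) ⟩
      shift (- + 1 - + t) (+ 0) (box (- + b) (+ t) (- + l) (- - + l))
        ≡⟨ box-cong (b′-left (+ t) (+ b)) (b′-right (+ t))
                    (+-identityʳ (- + l)) (trans (+-identityʳ (- - + l)) (neg-involutive (+ l))) ⟩
      box (- + m) (- + 1) (- + l) (+ l)
        ∎

    bbox-c′ : bbox c′ ≡ box (+ 1) (+ m) (- + l) (+ l)
    bbox-c′ = begin
      bbox c′
        ≡⟨ bbox-translate _ _ rc ⟩
      shift (+ 1 - left (bbox rc)) (- proj₂ (root rc)) (bbox rc)
        ≡⟨ cong₂ (λ r B → shift (+ 1 - left B) (- proj₂ r) B)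
                 (root-rotCCW G root≡) (trans (bbox-rotCCW G) (cong turnCCW bbox≡)) ⟩
      shift (+ 1 - - + t) (+ 0) (box (- + t) (- - + b) (- + l) (+ l))
        ≡⟨ box-cong (c′-left (+ t)) (c′-right (+ t) (+ b)) (+-identityʳ (- + l)) (+-identityʳ (+ l)) ⟩
      box (+ 1) (+ m) (- + l) (+ l)
        ∎

    lowest≡ : lowest ≡ - + l
    lowest≡ = trans (cong₂ (λ B C → bottom B ⊓ bottom C) bbox-b′ bbox-c′) (⊓-idem (- + l))

    bbox-a′ : bbox a′ ≡ box (- + l) (+ l) (- + (l ℕ.+ m)) (- + ℕ.suc l)
    bbox-a′ = begin
      bbox a′
        ≡⟨ bbox-translate _ _ G ⟩
      shift (- proj₁ (root G)) (lowest - + 1 - top (bbox G)) (bbox G)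
        ≡⟨ cong₂ (λ r B → shift (- proj₁ r) (lowest - + 1 - top B) B) root≡ bbox≡ ⟩
      shift (+ 0) (lowest - + 1 - + t) (box (- + l) (+ l) (- + b) (+ t))
        ≡⟨ cong (λ y → shift (+ 0) (y - + 1 - + t) (box (- + l) (+ l) (- + b) (+ t))) lowest≡ ⟩
      shift (+ 0) (- + l - + 1 - + t) (box (- + l) (+ l) (- + b) (+ t))
        ≡⟨ box-cong (+-identityʳ (- + l)) (+-identityʳ (+ l))
                    (a′-bottom (+ l) (+ t) (+ b)) (a′-top (+ l) (+ t)) ⟩
      box (- + l) (+ l) (- + (l ℕ.+ m)) (- + ℕ.suc l)
        ∎

open BoundingBox

open import Data.Nat using (ℕ; zero; suc; _≤_; z≤n; _+_; _*_; _∸_; _/_; _%_; _^_)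
open import Data.Nat.Properties using (m≤n+m; m≤m+n; ≤-trans; suc-injective)
open import Data.Nat.DivMod using (m*n/n≡m)
open import Data.Nat.Tactic.RingSolver using (solve)
open import Data.List using (_∷_; [])
open ≡-Reasoning

halfWidth above below : ℕ → ℕ
halfWidth zero = 0
halfWidth (suc n) = above n + below n + 1
above zero = 0
above (suc n) = halfWidth n
below zero = 0
below (suc n) = halfWidth n + (above n + below n + 1)

W H : ℕ → ℕ
W n = halfWidth n + halfWidth n + 1
H n = above n + below n + 1

halfWidth≤ : ∀ n → halfWidth n ≤ above n + below n + 1
halfWidth≤ zero = z≤n
halfWidth≤ (suc n) =
  ≤-trans (m≤n+m (H n) (above (suc n))) (≤-trans (m≤n+m _ (above (suc n))) (m≤m+n _ 1))

root-Γ′ : ∀ n → root (Γ' n) ≡ origin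
root-Γ′ zero = refl
root-Γ′ (suc n) = refl

bbox-Γ′ : ∀ n → bbox (Γ' n) ≡ box (- + halfWidth n) (+ halfWidth n) (- + below n) (+ above n)
bbox-Γ′ zero = refl
bbox-Γ′ (suc n) = bbox-construction2 (Γ' n) (root-Γ′ n) (bbox-Γ′ n) (halfWidth≤ n)

H-suc : ∀ n → H (suc n) ≡ W n + H n
H-suc n = regroup (halfWidth n) (H n)
  where
  regroup : ∀ l h → l + (l + h) + 1 ≡ l + l + 1 + h
  regroup l h = solve (l ∷ h ∷ [])

OddClosedForm EvenClosedForm : ℕ → Set
OddClosedForm n = 1 + W n * 3 ≡ 2 ^ (suc n + 1) × 1 + H n * 3 ≡ 2 ^ (suc n + 1)
EvenClosedForm n = W n * 3 ≡ 2 ^ (suc n + 1) + 1 × 2 + H n * 3 ≡ 2 ^ (suc n + 1)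

odd→even-sizes : ∀ w h {p} → 1 + w * 3 ≡ p → 1 + h * 3 ≡ p →
                 (h + h + 1) * 3 ≡ 2 * p + 1 × 2 + (w + h) * 3 ≡ 2 * p
odd→even-sizes w h {p} w≡ h≡ =
  (begin
    (h + h + 1) * 3       ≡⟨ solve (h ∷ []) ⟩
    2 * (1 + h * 3) + 1   ≡⟨ cong (λ x → 2 * x + 1) h≡ ⟩
    2 * p + 1             ∎) ,
  (begin
    2 + (w + h) * 3           ≡⟨ solve (w ∷ h ∷ []) ⟩
    (1 + w * 3) + (1 + h * 3) ≡⟨ cong₂ _+_ w≡ h≡ ⟩
    p + p                     ≡⟨ solve (p ∷ []) ⟩
    2 * p                     ∎)

even→odd-sizes : ∀ w h {p} → w * 3 ≡ p + 1 → 2 + h * 3 ≡ p →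
                 1 + (h + h + 1) * 3 ≡ 2 * p × 1 + (w + h) * 3 ≡ 2 * p
even→odd-sizes w h {p} w≡ h≡ =
  (begin
    1 + (h + h + 1) * 3 ≡⟨ solve (h ∷ []) ⟩
    2 * (2 + h * 3)     ≡⟨ cong (2 *_) h≡ ⟩
    2 * p               ∎) ,
  suc-injective (begin
    2 + (w + h) * 3       ≡⟨ solve (w ∷ h ∷ []) ⟩
    w * 3 + (2 + h * 3)   ≡⟨ cong₂ _+_ w≡ h≡ ⟩
    p + 1 + p             ≡⟨ solve (p ∷ []) ⟩
    1 + 2 * p             ∎)

odd→even : ∀ {n} → OddClosedForm n → EvenClosedForm (suc n)
odd→even {n} (w≡ , h≡) = proj₁ sizes , trans (cong (λ x → 2 + x * 3) (H-suc n)) (proj₂ sizes)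
  where
  sizes : (H n + H n + 1) * 3 ≡ 2 ^ (suc (suc n) + 1) + 1 × 2 + (W n + H n) * 3 ≡ 2 ^ (suc (suc n) + 1)
  sizes = odd→even-sizes (W n) (H n) w≡ h≡

even→odd : ∀ {n} → EvenClosedForm n → OddClosedForm (suc n)
even→odd {n} (w≡ , h≡) = proj₁ sizes , trans (cong (λ x → 1 + x * 3) (H-suc n)) (proj₂ sizes)
  where
  sizes : 1 + (H n + H n + 1) * 3 ≡ 2 ^ (suc (suc n) + 1) × 1 + (W n + H n) * 3 ≡ 2 ^ (suc (suc n) + 1)
  sizes = even→odd-sizes (W n) (H n) w≡ h≡

-- Two steps at a time, because suc (suc (suc n)) % 2 reduces to suc n % 2.
closedForm : ∀ n → (suc n % 2 ≡ 1 → OddClosedForm n) × (suc n % 2 ≡ 0 → EvenClosedForm n)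
closedForm zero = (λ _ → refl , refl) , λ ()
closedForm (suc zero) = (λ ()) , λ _ → refl , refl
closedForm (suc (suc n)) =
    even→odd {suc n} ∘ odd→even {n} ∘ proj₁ (closedForm n)
  , odd→even {suc n} ∘ even→odd {n} ∘ proj₂ (closedForm n)

m*3≡n⇒m≡n/3 : ∀ {m n} → m * 3 ≡ n → m ≡ n / 3
m*3≡n⇒m≡n/3 {m} refl = sym (m*n/n≡m m 3)

lemma2 : (h : ℕ) → (hpos : 1 ≤ h) →
    (h % 2 ≡ 1 → width (Γ h hpos) ≡ + ((2 ^ (h + 1) ∸ 1) / 3)
                × height (Γ h hpos) ≡ + ((2 ^ (h + 1) ∸ 1) / 3))
    × (h % 2 ≡ 0 → width (Γ h hpos) ≡ + ((2 ^ (h + 1) + 1) / 3)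
                × height (Γ h hpos) ≡ + ((2 ^ (h + 1) ∸ 2) / 3))
lemma2 zero ()
lemma2 (suc n) _ =
    sizes ∘ map (cong (_∸ 1)) (cong (_∸ 1)) ∘ proj₁ (closedForm n)
  , sizes ∘ map₂ (cong (_∸ 2)) ∘ proj₂ (closedForm n)
  where
  sizes : ∀ {x y} → W n * 3 ≡ x × H n * 3 ≡ y → width (Γ' n) ≡ + (x / 3) × height (Γ' n) ≡ + (y / 3)
  sizes (w≡ , h≡) = trans (width-of-bbox (Γ' n) (bbox-Γ′ n)) (cong +_ (m*3≡n⇒m≡n/3 w≡))
                  , trans (height-of-bbox (Γ' n) (bbox-Γ′ n)) (cong +_ (m*3≡n⇒m≡n/3 h≡))
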